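{- For $n\ge 1$ (with the convention $\mathrm{TH}_2=\mathrm{PF}_1(1)=\emptyset$), $|\mathrm{TH}_{n+1}|=|\mathrm{PF}_n(1)|=\frac{n!\,(n-1)}{2}$.
   Context: Parking functions: $n$ cars numbered $1,\dots,n$ enter in order a one-way street with spots $1,\dots,n$. Given $\alpha=(a_1,\dots,a_n)\in\{1,\dots,n\}^n$, car $i$ drives to spot $a_i$ and parks there if free, otherwise in the first free spot after $a_i$ (failing if none). $\alpha$ is a parking function if all cars park; its displacement is $\sum_i (p_i-a_i)$ where $p_i$ is the spot where car $i$ parks. $\mathrm{PF}_n(1)$ is the set of parking functions of length $n$ with displacement $1$. Tower of Hanoi: for $n\ge2$, the $(n+1)\times(n+1)$ game has disks $0,\dots,n$ labeled by increasing size and pegs $0,\dots,n$, disks on a peg stacked smaller above larger. An ideal state is an arrangement of all disks with disk $n$ alone on peg $0$, peg $n$ the only empty peg, and each of pegs $1,\dots,n-1$ holding at least one of the remaining $n$ disks. $\mathrm{TH}_{n+1}$ is the set of distinct ideal states. -}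

module Defs where

open import Data.Nat using (ℕ; zero; suc; _+_; _∸_; _≡ᵇ_; _≤ᵇ_; _<ᵇ_)
open import Data.Bool using (Bool; true; false; if_then_else_; _∧_; not; T)
open import Data.Maybe using (Maybe; just; nothing)
open import Data.List using (List; []; _∷_; allFin)
open import Data.Bool.ListAction using (any; all)
open import Data.Vec using (Vec; lookup; toList)
open import Data.Fin using (Fin; toℕ; fromℕ; inject₁)
open import Data.Product using (Σ)
open import Relation.Binary.PropositionalEquality using (_≡_)

-- A preference vector α : Vec (Fin n) n encodes (a₁,…,aₙ) ∈ {1,…,n}ⁿ
-- via aᵢ = toℕ (lookup α i) + 1.  Spots are the numbers 1,…,n.

occupied : ℕ → List ℕ → Bool
occupied p occ = any (λ q → p ≡ᵇ q) occ

firstFree : List ℕ → ℕ → ℕ → Maybe ℕ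
firstFree occ a zero       = nothing
firstFree occ a (suc fuel) =
  if occupied a occ then firstFree occ (suc a) fuel else just a

-- cars with preferences `prefs` enter in order, `occ` already taken;
-- returns the total displacement Σ (pᵢ - aᵢ) if all cars park, else nothing
parkRun : (n : ℕ) → List ℕ → List ℕ → Maybe ℕ
parkRun n []         occ = just 0
parkRun n (a ∷ prefs) occ with firstFree occ a (suc n ∸ a)
... | nothing = nothing
... | just p with parkRun n prefs (p ∷ occ)
...   | nothing = nothing
...   | just d  = just ((p ∸ a) + d)

-- displacement of α (nothing iff α is not a parking function)
displacement : (n : ℕ) → Vec (Fin n) n → Maybe ℕ
displacement n α = parkRun n (Data.List.map (λ i → suc (toℕ i)) (toList α)) []

PF₁ : ℕ → Set
PF₁ n = Σ (Vec (Fin n) n) (λ α → displacement n α ≡ just 1)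

-- A state assigns each disk d ∈ {0..n} a peg s[d] ∈ {0..n}; the order on
-- each peg is forced (smaller above larger), so states ≅ such assignments.

isIdeal : (n : ℕ) → Vec (Fin (suc n)) (suc n) → Bool
isIdeal n s =
  (toℕ (lookup s (fromℕ n)) ≡ᵇ 0)
  ∧ all (λ (d : Fin n) → not (toℕ (lookup s (inject₁ d)) ≡ᵇ 0)) (allFin n)
  ∧ all (λ (d : Fin (suc n)) → not (toℕ (lookup s d) ≡ᵇ n)) (allFin (suc n))
  ∧ all (λ (p : Fin (suc n)) →
           if (1 ≤ᵇ toℕ p) ∧ (toℕ p <ᵇ n)
           then any (λ (d : Fin n) → toℕ (lookup s (inject₁ d)) ≡ᵇ toℕ p) (allFin n)
           else true)
        (allFin (suc n))

-- TH n : the set TH_{n+1} of ideal states of the (n+1)×(n+1) game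
TH : ℕ → Set
TH n = Σ (Vec (Fin (suc n)) (suc n)) (λ s → T (isIdeal n s))

{-# OPTIONS --safe #-}
-- An ideal state is fixed by the pegs of the n smaller disks (the largest one sits alone
-- on peg 0), and these must cover exactly the inner pegs 1,…,n-1.  So ideal states are
-- the surjections from n disks onto n-1 pegs, and since the number S(m,k) of
-- surjections satisfies S(m+1,k+1) = (k+1)(S(m,k+1) + S(m,k)), we get
-- S(n+1,n) = n (n! + S(n,n-1)).
-- In a parking function of displacement 1 exactly one car finds its preferred spot a
-- taken and parks at a+1; every other car parks at its preference.  Splitting off the
-- last car gives PF₁(n+1) ≅ n × 𝔖ₙ ⊎ n × PF₁(n): either the last car is the bumped one,
-- and then the other cars prefer distinct spots, namely all spots but the one after the
-- last car's preference; or the last car parks at its preference x, deleting spot x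
-- turns the other cars into an element of PF₁(n), and x may be any spot except the one
-- taken by the bumped car of that element.  Both counts therefore satisfy
-- c(n+1) = n (n! + c(n)) with c(1) = 0, whose solution is n! (n-1) / 2.
module Submission where

open import Defs
open import Data.Nat using (ℕ; zero; suc; _≤_; _*_; _∸_; _/_; _!)
open import Data.Nat.Properties using (*-distribˡ-+)
open import Data.Fin using (Fin; zero)
open import Data.Product using (_×_; _,_)
open import Function.Bundles using (_↔_)
open import Data.Vec using ([]; _∷_)
open import Function.Properties.Inverse using (↔-refl; ↔-trans)
open import Relation.Binary.PropositionalEquality using (_≡_; sym)

module FiniteMaps where

  open import Data.Bool using (Bool; T)
  open import Data.Bool.Properties using (T-irrelevant)
  open import Data.Empty using (⊥-elim)
  open import Data.Unit using (⊤; tt)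
  open import Data.Fin using (Fin; zero; suc; toℕ; punchIn; punchOut)
  open import Data.Fin.Properties
    using (toℕ-injective; toℕ<n; punchIn-punchOut; punchOut-punchIn; punchOut-cong; punchInᵢ≢i; punchIn-injective; +↔⊎; *↔×)
    renaming (_≟_ to _≟ᶠ_; all? to allᶠ?)
  open import Data.Nat using (ℕ; zero; suc; _+_; _*_; _!; _≤_; s≤s)
  open import Data.Nat.Properties using (*-distribˡ-+; ≤-pred)
  open import Data.Product using (Σ; ∃; _×_; _,_; proj₁; proj₂)
  open import Data.Product.Function.NonDependent.Propositional using (_×-↔_)
  open import Data.Sum using (_⊎_; inj₁; inj₂)
  open import Data.Sum.Function.Propositional using (_⊎-↔_)
  open import Data.Vec using (Vec; []; _∷_; map; _∷ʳ_; init; last; initLast)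
  open import Data.Vec.Membership.Propositional using (_∈_; _∉_)
  open import Data.Vec.Membership.Propositional.Properties using (∈-map⁺)
  open import Data.Vec.Relation.Unary.Any using (here; there)
  open import Data.Vec.Relation.Unary.Any.Properties using (¬Any[])
  open import Function using (_∘_)
  open import Function.Bundles using (_↔_; mk↔ₛ′)
  open import Function.Properties.Inverse using (↔-refl; ↔-sym; ↔-trans)
  open import Relation.Binary.PropositionalEquality
  open import Relation.Nullary using (Dec; yes; no; ¬_; ¬?; Irrelevant)
  open import Relation.Nullary.Decidable using (True; toWitness; fromWitness; _×-dec_)

  Σ-≡-irrelevant : ∀ {A : Set} {P : A → Set} → (∀ {a} → Irrelevant (P a)) →
                   ∀ {a b} {p : P a} {q : P b} → a ≡ b → _≡_ {A = Σ A P} (a , p) (b , q)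
  Σ-≡-irrelevant irr {p = p} {q} refl = cong (_ ,_) (irr p q)

  Σ-T-≡ : ∀ {A : Set} {P : A → Bool} {a b} {p : T (P a)} {q : T (P b)} →
          a ≡ b → _≡_ {A = Σ A (λ x → T (P x))} (a , p) (b , q)
  Σ-T-≡ = Σ-≡-irrelevant T-irrelevant

  ∅↔Fin0 : ∀ {A : Set} → ¬ A → A ↔ Fin 0
  ∅↔Fin0 ¬a = mk↔ₛ′ (⊥-elim ∘ ¬a) (λ ()) (λ ()) (⊥-elim ∘ ¬a)

  ↔Fin-cast : ∀ {A : Set} {a b} → a ≡ b → A ↔ Fin a → A ↔ Fin b
  ↔Fin-cast refl A↔ = A↔

  ×↔Fin : ∀ {A B : Set} {a b} → A ↔ Fin a → B ↔ Fin b → (A × B) ↔ Fin (a * b)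
  ×↔Fin A↔ B↔ = ↔-trans (A↔ ×-↔ B↔) (↔-sym *↔×)

  ⊎↔Fin : ∀ {A B : Set} {a b} → A ↔ Fin a → B ↔ Fin b → (A ⊎ B) ↔ Fin (a + b)
  ⊎↔Fin A↔ B↔ = ↔-trans (A↔ ⊎-↔ B↔) (↔-sym +↔⊎)

  ∈-map⁻ : ∀ {A B : Set} {m} (f : A → B) {xs : Vec A m} {y} → y ∈ map f xs → ∃ λ x → x ∈ xs × y ≡ f x
  ∈-map⁻ f {x ∷ xs} (here y≡fx) = x , here refl , y≡fx
  ∈-map⁻ f {x ∷ xs} (there y∈) with ∈-map⁻ f y∈
  ... | z , z∈ , y≡fz = z , there z∈ , y≡fz

  module _ {k : ℕ} where
    open import Data.Vec.Membership.DecPropositional (_≟ᶠ_ {k}) public using (_∈?_)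

  Onto : ∀ {m k} → Vec (Fin k) m → Set
  Onto {k = k} v = ∀ (y : Fin k) → y ∈ v

  punchOutAll : ∀ {m k} (x : Fin (suc k)) (w : Vec (Fin (suc k)) m) → x ∉ w → Vec (Fin k) m
  punchOutAll x []      x∉w = []
  punchOutAll x (z ∷ w) x∉w = punchOut (x∉w ∘ here) ∷ punchOutAll x w (x∉w ∘ there)

  map-punchIn-punchOutAll : ∀ {m k} (x : Fin (suc k)) (w : Vec (Fin (suc k)) m) (x∉w : x ∉ w) →
                            map (punchIn x) (punchOutAll x w x∉w) ≡ w
  map-punchIn-punchOutAll x []      x∉w = refl
  map-punchIn-punchOutAll x (z ∷ w) x∉w = cong₂ _∷_ (punchIn-punchOut _) (map-punchIn-punchOutAll x w _)

  punchOutAll-map-punchIn : ∀ {m k} {x x′ : Fin (suc k)} → x ≡ x′ → (u : Vec (Fin k) m) (x∉ : x ∉ map (punchIn x′) u) →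
                            punchOutAll x (map (punchIn x′) u) x∉ ≡ u
  punchOutAll-map-punchIn refl []      x∉ = refl
  punchOutAll-map-punchIn {x = x} refl (z ∷ u) x∉ =
    cong₂ _∷_ (trans (punchOut-cong x refl) (punchOut-punchIn x)) (punchOutAll-map-punchIn refl u _)

  ∉-map-punchIn : ∀ {m k} (x : Fin (suc k)) (u : Vec (Fin k) m) → x ∉ map (punchIn x) u
  ∉-map-punchIn x u x∈ with ∈-map⁻ (punchIn x) x∈
  ... | y , _ , x≡ = punchInᵢ≢i x y (sym x≡)

  ∈-punchOutAll : ∀ {m k} (x : Fin (suc k)) (w : Vec (Fin (suc k)) m) (x∉w : x ∉ w) {y} →
                  punchIn x y ∈ w → y ∈ punchOutAll x w x∉w
  ∈-punchOutAll x (z ∷ w) x∉w (here refl) = here (sym (trans (punchOut-cong x refl) (punchOut-punchIn x)))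
  ∈-punchOutAll x (z ∷ w) x∉w (there y∈)  = there (∈-punchOutAll x w _ y∈)

  onto-punchIn : ∀ {m k} (x : Fin (suc k)) {u : Vec (Fin k) m} → Onto u →
                 ∀ y → x ≢ y → y ∈ map (punchIn x) u
  onto-punchIn x {u} onto y x≢y = subst (_∈ map (punchIn x) u) (punchIn-punchOut x≢y) (∈-map⁺ (punchIn x) (onto _))

  onto? : ∀ {m k} (v : Vec (Fin k) m) → Dec (Onto v)
  onto? v = allᶠ? (_∈? v)

  Surjections : ℕ → ℕ → Set
  Surjections m k = Σ (Vec (Fin k) m) (True ∘ onto?)

  surjCount : ℕ → ℕ → ℕ
  surjCount zero    zero    = 1
  surjCount zero    (suc k) = 0
  surjCount (suc m) zero    = 0
  surjCount (suc m) (suc k) = suc k * (surjCount m (suc k) + surjCount m k)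

  module SurjectionsStep {m k : ℕ} where

    Split : Set
    Split = (Fin (suc k) × Surjections m (suc k)) ⊎ (Fin (suc k) × Surjections m k)

    ∉-of-¬onto : (x : Fin (suc k)) (w : Vec (Fin (suc k)) m) → Onto (x ∷ w) → ¬ Onto w → x ∉ w
    ∉-of-¬onto x w onto ¬onto x∈w = ¬onto λ y → tail (onto y)
      where tail : ∀ {y} → y ∈ x ∷ w → y ∈ w
            tail (here refl) = x∈w
            tail (there y∈w) = y∈w

    split : (x : Fin (suc k)) (w : Vec (Fin (suc k)) m) → Onto (x ∷ w) → Dec (Onto w) → Split
    split x w _    (yes onto) = inj₁ (x , w , fromWitness onto)
    split x w onto (no ¬onto) = inj₂ (x , punchOutAll x w x∉w , fromWitness onto′)
      where
        x∉w : x ∉ w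
        x∉w = ∉-of-¬onto x w onto ¬onto
        onto′ : Onto (punchOutAll x w x∉w)
        onto′ y with onto (punchIn x y)
        ... | here x≡ = ⊥-elim (punchInᵢ≢i x y x≡)
        ... | there y∈ = ∈-punchOutAll x w x∉w y∈

    to : Surjections (suc m) (suc k) → Split
    to (x ∷ w , p) = split x w (toWitness p) (onto? w)

    from : Split → Surjections (suc m) (suc k)
    from (inj₁ (x , w , p)) = x ∷ w , fromWitness (there ∘ toWitness p)
    from (inj₂ (x , u , p)) = x ∷ map (punchIn x) u , fromWitness onto
      where onto : Onto (x ∷ map (punchIn x) u)
            onto y with x ≟ᶠ y
            ... | yes refl = here refl
            ... | no x≢y  = there (onto-punchIn x (toWitness p) y x≢y)

    from-split : ∀ x w onto d → proj₁ (from (split x w onto d)) ≡ x ∷ w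
    from-split x w _ (yes _) = refl
    from-split x w _ (no _)  = cong (x ∷_) (map-punchIn-punchOutAll x w _)

    split-inj₁ : ∀ x w (p : True (onto? w)) onto d → split x w onto d ≡ inj₁ (x , w , p)
    split-inj₁ x w p _ (yes _)    = cong (λ q → inj₁ (x , w , q)) (T-irrelevant _ p)
    split-inj₁ x w p _ (no ¬onto) = ⊥-elim (¬onto (toWitness p))

    split-inj₂ : ∀ x u (p : True (onto? u)) onto d → split x (map (punchIn x) u) onto d ≡ inj₂ (x , u , p)
    split-inj₂ x u p _ (yes onto′) = ⊥-elim (∉-map-punchIn x u (onto′ x))
    split-inj₂ x u p _ (no _)      = cong (λ v → inj₂ (x , v)) (Σ-T-≡ (punchOutAll-map-punchIn refl u _))

    iso : Surjections (suc m) (suc k) ↔ Split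
    iso = mk↔ₛ′ to from to∘from from∘to
      where
        to∘from : ∀ s → to (from s) ≡ s
        to∘from (inj₁ (x , w , p)) = split-inj₁ x w p _ (onto? w)
        to∘from (inj₂ (x , u , p)) = split-inj₂ x u p _ (onto? (map (punchIn x) u))
        from∘to : ∀ s → from (to s) ≡ s
        from∘to (x ∷ w , p) = Σ-T-≡ (from-split x w _ (onto? w))

  Surjections↔ : ∀ m k → Surjections m k ↔ Fin (surjCount m k)
  Surjections↔ zero    zero    = mk↔ₛ′ (λ _ → zero) (λ _ → [] , _) (λ { zero → refl }) (λ { ([] , _) → refl })
  Surjections↔ zero    (suc k) = ∅↔Fin0 λ { ([] , p) → ¬Any[] (toWitness {a? = onto? {k = suc k} []} p zero) }
  Surjections↔ (suc m) zero    = ∅↔Fin0 λ { (() ∷ _ , _) }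
  Surjections↔ (suc m) (suc k) =
    ↔Fin-cast (sym (*-distribˡ-+ (suc k) (surjCount m (suc k)) (surjCount m k)))
      (↔-trans SurjectionsStep.iso
        (⊎↔Fin (×↔Fin (↔-refl {A = Fin (suc k)}) (Surjections↔ m (suc k)))
               (×↔Fin (↔-refl {A = Fin (suc k)}) (Surjections↔ m k))))

  Distinct : ∀ {A : Set} {m} → Vec A m → Set
  Distinct []       = ⊤
  Distinct (x ∷ xs) = x ∉ xs × Distinct xs

  distinct? : ∀ {m k} (v : Vec (Fin k) m) → Dec (Distinct v)
  distinct? []      = yes tt
  distinct? (x ∷ w) = ¬? (x ∈? w) ×-dec distinct? w

  Injections : ℕ → ℕ → Set
  Injections m k = Σ (Vec (Fin k) m) (True ∘ distinct?)

  distinct-map⁻ : ∀ {A B : Set} {m} (f : A → B) (u : Vec A m) → Distinct (map f u) → Distinct u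
  distinct-map⁻ f []      _              = tt
  distinct-map⁻ f (y ∷ u) (fy∉ , dist) = fy∉ ∘ ∈-map⁺ f , distinct-map⁻ f u dist

  distinct-map⁺ : ∀ {A B : Set} {m} {f : A → B} → (∀ {a b} → f a ≡ f b → a ≡ b) →
                  (u : Vec A m) → Distinct u → Distinct (map f u)
  distinct-map⁺ f-inj []      _            = tt
  distinct-map⁺ {f = f} f-inj (y ∷ u) (y∉ , dist) = fy∉ , distinct-map⁺ f-inj u dist
    where fy∉ : f y ∉ map f u
          fy∉ fy∈ with ∈-map⁻ f fy∈
          ... | z , z∈ , fy≡fz = y∉ (subst (_∈ u) (sym (f-inj fy≡fz)) z∈)

  distinct-punchOutAll : ∀ {m k} (x : Fin (suc k)) (w : Vec (Fin (suc k)) m) (x∉w : x ∉ w) →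
                         Distinct w → Distinct (punchOutAll x w x∉w)
  distinct-punchOutAll x w x∉w dist =
    distinct-map⁻ (punchIn x) _ (subst Distinct (sym (map-punchIn-punchOutAll x w x∉w)) dist)

  distinct-map-punchIn : ∀ {m k} (x : Fin (suc k)) (u : Vec (Fin k) m) → Distinct u → Distinct (map (punchIn x) u)
  distinct-map-punchIn x = distinct-map⁺ (punchIn-injective x _ _)

  Injections-suc↔ : ∀ {m k} → Injections (suc m) (suc k) ↔ (Fin (suc k) × Injections m k)
  Injections-suc↔ = mk↔ₛ′ to from to∘from from∘to
    where
      to : Injections _ _ → Fin _ × Injections _ _
      to (x ∷ w , p) = let x∉w , dist = toWitness p in
        x , punchOutAll x w x∉w , fromWitness (distinct-punchOutAll x w x∉w dist)
      from : Fin _ × Injections _ _ → Injections _ _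
      from (x , u , p) = x ∷ map (punchIn x) u , fromWitness (∉-map-punchIn x u , distinct-map-punchIn x u (toWitness p))
      to∘from : ∀ s → to (from s) ≡ s
      to∘from (x , u , p) = cong (x ,_) (Σ-T-≡ (punchOutAll-map-punchIn refl u _))
      from∘to : ∀ s → from (to s) ≡ s
      from∘to (x ∷ w , p) = Σ-T-≡ (cong (x ∷_) (map-punchIn-punchOutAll x w _))

  Permutations↔ : ∀ m → Injections m m ↔ Fin (m !)
  Permutations↔ zero    = mk↔ₛ′ (λ _ → zero) (λ _ → [] , _) (λ { zero → refl }) (λ { ([] , _) → refl })
  Permutations↔ (suc m) = ↔-trans Injections-suc↔ (×↔Fin ↔-refl (Permutations↔ m))

  distinct⇒onto : ∀ {m} (v : Vec (Fin m) m) → Distinct v → Onto v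
  distinct⇒onto (x ∷ w) (x∉w , dist) y with x ≟ᶠ y
  ... | yes refl = here refl
  ... | no x≢y  = there (subst (y ∈_) (map-punchIn-punchOutAll x w x∉w)
                    (onto-punchIn x (distinct⇒onto _ (distinct-punchOutAll x w x∉w dist)) y x≢y))

  clamp : (m : ℕ) → ℕ → Fin (suc m)
  clamp m       zero    = zero
  clamp zero    (suc v) = zero
  clamp (suc m) (suc v) = suc (clamp m v)

  toℕ-clamp : ∀ {m v} → v ≤ m → toℕ (clamp m v) ≡ v
  toℕ-clamp {m}     {zero}  _         = refl
  toℕ-clamp {suc m} {suc v} (s≤s v≤m) = cong suc (toℕ-clamp v≤m)

  clamp-toℕ : ∀ m (y : Fin (suc m)) → clamp m (toℕ y) ≡ y
  clamp-toℕ m y = toℕ-injective (toℕ-clamp (≤-pred (toℕ<n y)))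

  init∷ʳlast : ∀ {A : Set} {n} (s : Vec A (suc n)) → s ≡ init s ∷ʳ last s
  init∷ʳlast s = proj₂ (proj₂ (initLast s))

module Counts where

  open import Data.Nat using (ℕ; zero; suc; _+_; _*_; _∸_; _/_; _!; _<_; s≤s)
  open import Data.Nat.Properties using (*-zeroʳ; n<1+n; m<n⇒m<1+n)
  open import Data.Nat.DivMod using (m*n/n≡m)
  open import Data.Nat.Solver using (module +-*-Solver)
  open import Relation.Binary.PropositionalEquality

  open FiniteMaps

  pf₁Count : ℕ → ℕ
  pf₁Count zero          = 0
  pf₁Count (suc zero)    = 0
  pf₁Count (suc (suc k)) = suc k * (suc k ! + pf₁Count (suc k))

  m<k⇒surjCount[m,k]≡0 : ∀ {m k} → m < k → surjCount m k ≡ 0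
  m<k⇒surjCount[m,k]≡0 {zero}  {suc k} _         = refl
  m<k⇒surjCount[m,k]≡0 {suc m} {suc k} (s≤s m<k)
    rewrite m<k⇒surjCount[m,k]≡0 (m<n⇒m<1+n m<k) | m<k⇒surjCount[m,k]≡0 m<k = *-zeroʳ k

  surjCount[n,n]≡n! : ∀ n → surjCount n n ≡ n !
  surjCount[n,n]≡n! zero = refl
  surjCount[n,n]≡n! (suc n) rewrite m<k⇒surjCount[m,k]≡0 (n<1+n n) | surjCount[n,n]≡n! n = refl

  surjCount[1+n,n]≡pf₁Count[1+n] : ∀ n → surjCount (suc n) n ≡ pf₁Count (suc n)
  surjCount[1+n,n]≡pf₁Count[1+n] zero    = refl
  surjCount[1+n,n]≡pf₁Count[1+n] (suc n) rewrite surjCount[n,n]≡n! (suc n) | surjCount[1+n,n]≡pf₁Count[1+n] n = refl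

  pf₁Count[1+k]*2≡[1+k]!*k : ∀ k → pf₁Count (suc k) * 2 ≡ suc k ! * k
  pf₁Count[1+k]*2≡[1+k]!*k zero    = refl
  pf₁Count[1+k]*2≡[1+k]!*k (suc k) = begin
      suc k * (f + q) * 2       ≡⟨ solve 3 (λ k f q → (con 1 :+ k) :* (f :+ q) :* con 2
                                                   := (con 1 :+ k) :* (f :* con 2 :+ q :* con 2)) refl k f q ⟩
      suc k * (f * 2 + q * 2)   ≡⟨ cong (λ t → suc k * (f * 2 + t)) (pf₁Count[1+k]*2≡[1+k]!*k k) ⟩
      suc k * (f * 2 + f * k)   ≡⟨ solve 2 (λ k f → (con 1 :+ k) :* (f :* con 2 :+ f :* k)
                                                 := (con 2 :+ k) :* f :* (con 1 :+ k)) refl k f ⟩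
      (2 + k) * f * suc k       ∎
    where open ≡-Reasoning
          open +-*-Solver
          f q : ℕ
          f = suc k !
          q = pf₁Count (suc k)

  [1+k]!*k/2≡pf₁Count[1+k] : ∀ k → (suc k ! * (suc k ∸ 1)) / 2 ≡ pf₁Count (suc k)
  [1+k]!*k/2≡pf₁Count[1+k] k = trans (cong (_/ 2) (sym (pf₁Count[1+k]*2≡[1+k]!*k k))) (m*n/n≡m (pf₁Count (suc k)) 2)

module Hanoi where

  open import Data.Bool using (Bool; true; false; T; not; _∧_; if_then_else_)
  open import Data.Bool.ListAction using (any; all)
  open import Data.Bool.Properties using (T-∧)
  open import Data.Empty using (⊥; ⊥-elim)
  open import Data.Fin using (Fin; zero; suc; toℕ; fromℕ; inject₁)
  open import Data.Fin.Properties using (toℕ-injective; toℕ-inject₁; toℕ<n)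
  open import Data.List using (allFin)
  import Data.List.Relation.Unary.All.Properties as Allₚ
  import Data.List.Relation.Unary.Any.Properties as Anyₚ
  open import Data.Nat using (ℕ; zero; suc; pred; _≤_; _<_; z≤n; s≤s; _≡ᵇ_; _≤ᵇ_; _<ᵇ_)
  open import Data.Nat.Properties using (≡ᵇ⇒≡; ≡⇒≡ᵇ; ≤ᵇ⇒≤; ≤⇒≤ᵇ; <ᵇ⇒<; <⇒<ᵇ; <-irrefl; ≤∧≢⇒<; ≤-pred)
  open import Data.Product using (∃; _×_; _,_)
  open import Data.Sum using (_⊎_; inj₁; inj₂)
  open import Data.Vec using (Vec; []; _∷_; lookup; map; _∷ʳ_; init; last)
  open import Data.Vec.Membership.Propositional using (_∈_)
  open import Data.Vec.Membership.Propositional.Properties using (∈-lookup)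
  open import Data.Vec.Properties using (init-∷ʳ; map-∘; map-cong; map-id; lookup-map)
  open import Data.Vec.Relation.Unary.Any.Properties using (lookup-index)
  open import Data.Vec.Relation.Unary.Any using (here; there; index)
  open import Function using (_∘_)
  open import Function.Bundles using (_↔_; mk↔ₛ′; _⇔_; mk⇔; Equivalence)
  open import Relation.Binary.PropositionalEquality
  open import Relation.Nullary using (¬_)
  open import Relation.Nullary.Decidable using (toWitness; fromWitness)
  open Equivalence using (to; from)

  open FiniteMaps

  lookup-∷ʳ-fromℕ : ∀ {A : Set} {n} (v : Vec A n) z → lookup (v ∷ʳ z) (fromℕ n) ≡ z
  lookup-∷ʳ-fromℕ []      z = refl
  lookup-∷ʳ-fromℕ (x ∷ v) z = lookup-∷ʳ-fromℕ v z

  lookup-∷ʳ-inject₁ : ∀ {A : Set} {n} (v : Vec A n) z d → lookup (v ∷ʳ z) (inject₁ d) ≡ lookup v d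
  lookup-∷ʳ-inject₁ (x ∷ v) z zero    = refl
  lookup-∷ʳ-inject₁ (x ∷ v) z (suc d) = lookup-∷ʳ-inject₁ v z d

  fromℕ-or-inject₁ : ∀ {n} (i : Fin (suc n)) → i ≡ fromℕ n ⊎ ∃ λ d → i ≡ inject₁ d
  fromℕ-or-inject₁ {zero}  zero    = inj₁ refl
  fromℕ-or-inject₁ {suc n} zero    = inj₂ (zero , refl)
  fromℕ-or-inject₁ {suc n} (suc i) with fromℕ-or-inject₁ i
  ... | inj₁ refl      = inj₁ refl
  ... | inj₂ (d , refl) = inj₂ (suc d , refl)

  T-not : ∀ {b} → T (not b) ⇔ (¬ T b)
  T-not {true}  = mk⇔ (λ ()) (λ ¬t → ¬t _)
  T-not {false} = mk⇔ (λ _ ()) _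

  T-≢ᵇ : ∀ {m n} → T (not (m ≡ᵇ n)) ⇔ (m ≢ n)
  T-≢ᵇ {m} {n} = mk⇔ (λ t m≡n → T-not .to t (≡⇒≡ᵇ m n m≡n)) (λ m≢n → T-not .from (m≢n ∘ ≡ᵇ⇒≡ m n))

  T-if-else-true : ∀ {c x} → T (if c then x else true) ⇔ (T c → T x)
  T-if-else-true {true}  = mk⇔ (λ t _ → t) (λ f → f _)
  T-if-else-true {false} = mk⇔ (λ _ ()) _

  T-all-allFin : ∀ {n} (p : Fin n → Bool) → T (all p (allFin n)) ⇔ (∀ i → T (p i))
  T-all-allFin p = mk⇔ (Allₚ.tabulate⁻ ∘ Allₚ.all⁺ p _) (Allₚ.all⁻ p ∘ Allₚ.tabulate⁺)

  T-any-allFin : ∀ {n} (p : Fin n → Bool) → T (any p (allFin n)) ⇔ (∃ λ i → T (p i))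
  T-any-allFin p = mk⇔ (Anyₚ.tabulate⁻ ∘ Anyₚ.any⁻ p _) (λ (i , t) → Anyₚ.any⁺ p (Anyₚ.tabulate⁺ i t))

  record Ideal (n : ℕ) (s : Vec (Fin (suc n)) (suc n)) : Set where
    field
      largest-on-0    : toℕ (lookup s (fromℕ n)) ≡ 0
      others-off-0    : ∀ d → toℕ (lookup s (inject₁ d)) ≢ 0
      last-peg-empty  : ∀ d → toℕ (lookup s d) ≢ n
      inner-pegs-used : ∀ (p : Fin (suc n)) → 1 ≤ toℕ p → toℕ p < n →
                        ∃ λ (d : Fin n) → toℕ (lookup s (inject₁ d)) ≡ toℕ p

  T-isIdeal : ∀ n s → T (isIdeal n s) ⇔ Ideal n s
  T-isIdeal n s = mk⇔ decode encode
    where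
      -- T-∧ cannot infer the conjuncts of isIdeal from their conjunction, so they are named.
      b₁ b₂ b₃ : Bool
      b₁ = toℕ (lookup s (fromℕ n)) ≡ᵇ 0
      b₂ = all (λ d → not (toℕ (lookup s (inject₁ d)) ≡ᵇ 0)) (allFin n)
      b₃ = all (λ d → not (toℕ (lookup s d) ≡ᵇ n)) (allFin (suc n))
      inner : Fin (suc n) → Bool
      inner p = (1 ≤ᵇ toℕ p) ∧ (toℕ p <ᵇ n)
      holds : Fin (suc n) → Fin n → Bool
      holds p d = toℕ (lookup s (inject₁ d)) ≡ᵇ toℕ p
      used : Fin (suc n) → Bool
      used p = if inner p then any (holds p) (allFin n) else true

      decode : T (isIdeal n s) → Ideal n s
      decode t = let c₁ , t′ = T-∧ {b₁} .to t ; c₂ , t″ = T-∧ {b₂} .to t′ ; c₃ , c₄ = T-∧ {b₃} .to t″ in record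
        { largest-on-0    = ≡ᵇ⇒≡ _ 0 c₁
        ; others-off-0    = λ d → T-≢ᵇ .to (T-all-allFin _ .to c₂ d)
        ; last-peg-empty  = λ d → T-≢ᵇ .to (T-all-allFin _ .to c₃ d)
        ; inner-pegs-used = λ p 1≤p p<n →
            let d , t = T-any-allFin (holds p) .to (T-if-else-true {inner p} .to (T-all-allFin used .to c₄ p)
                                                                           (T-∧ .from (≤⇒≤ᵇ 1≤p , <⇒<ᵇ p<n)))
            in d , ≡ᵇ⇒≡ _ _ t
        }
      encode : Ideal n s → T (isIdeal n s)
      encode I = T-∧ {b₁} .from (≡⇒≡ᵇ _ 0 largest-on-0 , T-∧ {b₂} .from (
                 T-all-allFin _ .from (λ d → T-≢ᵇ .from (others-off-0 d)) , T-∧ {b₃} .from (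
                 T-all-allFin _ .from (λ d → T-≢ᵇ .from (last-peg-empty d)) ,
                 T-all-allFin used .from λ p → T-if-else-true {inner p} .from λ c →
                   let 1≤p , p<n = T-∧ {1 ≤ᵇ toℕ p} .to c
                       d , eq = inner-pegs-used p (≤ᵇ⇒≤ 1 _ 1≤p) (<ᵇ⇒< _ n p<n)
                   in T-any-allFin (holds p) .from (d , ≡⇒≡ᵇ _ _ eq))))
        where open Ideal I

  map-id-∈ : ∀ {A : Set} {m} (f : A → A) (v : Vec A m) → (∀ x → x ∈ v → f x ≡ x) → map f v ≡ v
  map-id-∈ f []      fx≡x = refl
  map-id-∈ f (y ∷ v) fx≡x = cong₂ _∷_ (fx≡x y (here refl)) (map-id-∈ f v (λ x → fx≡x x ∘ there))

  lookup-init : ∀ {A : Set} {n} (s : Vec A (suc n)) d → lookup (init s) d ≡ lookup s (inject₁ d)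
  lookup-init s d = trans (sym (lookup-∷ʳ-inject₁ (init s) (last s) d))
                          (cong (λ t → lookup t (inject₁ d)) (sym (init∷ʳlast s)))

  lookup-fromℕ : ∀ {A : Set} {n} (s : Vec A (suc n)) → lookup s (fromℕ n) ≡ last s
  lookup-fromℕ s = trans (cong (λ t → lookup t _) (init∷ʳlast s)) (lookup-∷ʳ-fromℕ (init s) (last s))

  -- For n = m + 2, the ideal states are the states `state g` for g a surjection from the
  -- n smaller disks onto the m + 1 inner pegs.
  module IdealStates (m : ℕ) where

    n : ℕ
    n = suc (suc m)

    peg : Fin (suc m) → Fin (suc n)
    peg y = suc (inject₁ y)

    toℕ-peg : ∀ y → toℕ (peg y) ≡ suc (toℕ y)
    toℕ-peg y = cong suc (toℕ-inject₁ y)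

    -- Junk outside the inner pegs.
    pegIndex : Fin (suc n) → Fin (suc m)
    pegIndex p = clamp m (pred (toℕ p))

    pegIndex-peg : ∀ y → pegIndex (peg y) ≡ y
    pegIndex-peg y = trans (cong (clamp m) (toℕ-inject₁ y)) (clamp-toℕ m y)

    peg-pegIndex : ∀ p → toℕ p ≢ 0 → toℕ p ≢ n → peg (pegIndex p) ≡ p
    peg-pegIndex zero    p≢0 _   = ⊥-elim (p≢0 refl)
    peg-pegIndex (suc p) _   p≢n = toℕ-injective (trans (toℕ-peg _) (cong suc (toℕ-clamp p≤m)))
      where p≤m : toℕ p ≤ m
            p≤m = ≤-pred (≤∧≢⇒< (≤-pred (toℕ<n p)) (p≢n ∘ cong suc))

    state : Vec (Fin (suc m)) n → Vec (Fin (suc n)) (suc n)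
    state g = map peg g ∷ʳ zero

    toℕ-state-inject₁ : ∀ g d → toℕ (lookup (state g) (inject₁ d)) ≡ suc (toℕ (lookup g d))
    toℕ-state-inject₁ g d =
      trans (cong toℕ (trans (lookup-∷ʳ-inject₁ (map peg g) zero d) (lookup-map d peg g))) (toℕ-peg (lookup g d))

    state-ideal : ∀ g → Onto g → Ideal n (state g)
    state-ideal g onto = record
      { largest-on-0    = cong toℕ (lookup-∷ʳ-fromℕ (map peg g) zero)
      ; others-off-0    = λ d eq → 0≢1+ (trans (sym eq) (toℕ-state-inject₁ g d))
      ; last-peg-empty  = last-peg-empty
      ; inner-pegs-used = inner-pegs-used
      }
      where
        0≢1+ : ∀ {a} → 0 ≢ suc a
        0≢1+ ()
        last-peg-empty : ∀ d → toℕ (lookup (state g) d) ≢ n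
        last-peg-empty d with fromℕ-or-inject₁ d
        ... | inj₁ refl       = λ eq → 0≢1+ (trans (sym (cong toℕ (lookup-∷ʳ-fromℕ (map peg g) zero))) eq)
        ... | inj₂ (d′ , refl) = λ eq → <-irrefl eq
                                  (subst (_< n) (sym (toℕ-state-inject₁ g d′)) (s≤s (toℕ<n (lookup g d′))))
        inner-pegs-used : ∀ p → 1 ≤ toℕ p → toℕ p < n → ∃ λ d → toℕ (lookup (state g) (inject₁ d)) ≡ toℕ p
        inner-pegs-used (suc p) _ (s≤s p<1+m) =
          index y∈g , trans (toℕ-state-inject₁ g (index y∈g))
                            (cong suc (trans (cong toℕ (sym (lookup-index y∈g))) (toℕ-clamp (≤-pred p<1+m))))
          where y∈g : clamp m (toℕ p) ∈ g
                y∈g = onto (clamp m (toℕ p))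

    inner-entries : ∀ {s} → Ideal n s → ∀ p → p ∈ init s → toℕ p ≢ 0 × toℕ p ≢ n
    inner-entries {s} I p p∈ = (λ eq → others-off-0 d (trans (cong toℕ (sym p≡sd)) eq))
                             , (λ eq → last-peg-empty (inject₁ d) (trans (cong toℕ (sym p≡sd)) eq))
      where
        open Ideal I
        d : Fin n
        d = index p∈
        p≡sd : p ≡ lookup s (inject₁ d)
        p≡sd = trans (lookup-index p∈) (lookup-init s d)

    assignment-onto : ∀ {s} → Ideal n s → Onto (map pegIndex (init s))
    assignment-onto {s} I y =
      let d , eq = inner-pegs-used (peg y) (subst (1 ≤_) (sym (toℕ-peg y)) (s≤s z≤n))
                                           (subst (_< n) (sym (toℕ-peg y)) (s≤s (toℕ<n y)))
      in subst (_∈ map pegIndex (init s))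
               (trans (lookup-map d pegIndex (init s))
                      (trans (cong pegIndex (trans (lookup-init s d) (toℕ-injective eq))) (pegIndex-peg y)))
               (∈-lookup d (map pegIndex (init s)))
      where open Ideal I

    TH↔Surjections : TH n ↔ Surjections n (suc m)
    TH↔Surjections = mk↔ₛ′ assignment stateOf assignment∘stateOf stateOf∘assignment
      where
        assignment : TH n → Surjections n (suc m)
        assignment (s , t) = map pegIndex (init s) , fromWitness (assignment-onto (T-isIdeal n s .to t))
        stateOf : Surjections n (suc m) → TH n
        stateOf (g , p) = state g , T-isIdeal n (state g) .from (state-ideal g (toWitness p))
        assignment∘stateOf : ∀ g → assignment (stateOf g) ≡ g
        assignment∘stateOf (g , p) = Σ-T-≡ (begin
          map pegIndex (init (map peg g ∷ʳ zero)) ≡⟨ cong (map pegIndex) (init-∷ʳ zero (map peg g)) ⟩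
          map pegIndex (map peg g)                ≡⟨ map-∘ pegIndex peg g ⟨
          map (pegIndex ∘ peg) g                  ≡⟨ map-cong pegIndex-peg g ⟩
          map (λ y → y) g                         ≡⟨ map-id g ⟩
          g                                       ∎)
          where open ≡-Reasoning
        stateOf∘assignment : ∀ s → stateOf (assignment s) ≡ s
        stateOf∘assignment (s , t) = Σ-T-≡ (begin
          map peg (map pegIndex (init s)) ∷ʳ zero ≡⟨ cong₂ _∷ʳ_ entries largest ⟩
          init s ∷ʳ last s                        ≡⟨ init∷ʳlast s ⟨
          s                                       ∎)
          where
            open ≡-Reasoning
            I : Ideal n s
            I = T-isIdeal n s .to t
            entries : map peg (map pegIndex (init s)) ≡ init s
            entries = trans (sym (map-∘ peg pegIndex (init s)))
                            (map-id-∈ _ (init s) λ p p∈ → let p≢0 , p≢n = inner-entries I p p∈ in peg-pegIndex p p≢0 p≢n)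
            largest : zero ≡ last s
            largest = toℕ-injective (sym (trans (cong toℕ (sym (lookup-fromℕ s))) (Ideal.largest-on-0 I)))

  TH₁-empty : ¬ TH 1
  TH₁-empty (s , t) = no-peg (lookup s zero) (others-off-0 zero) (last-peg-empty zero)
    where
      open Ideal (T-isIdeal 1 s .to t)
      no-peg : (p : Fin 2) → toℕ p ≢ 0 → toℕ p ≢ 1 → ⊥
      no-peg zero       p≢0 _   = p≢0 refl
      no-peg (suc zero) _   p≢1 = p≢1 refl

module Parking where

  open import Data.Bool using (true; false; T)
  open import Data.Bool.Properties using (T-≡)
  open import Data.Empty using (⊥-elim)
  open import Data.List using (List; []; _∷_)
  open import Data.List.Membership.Propositional using (_∈_; _∉_)
  open import Data.List.Relation.Unary.All using (All; []; _∷_)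
  import Data.List.Relation.Unary.Any as Any
  open import Data.List.Relation.Unary.Any.Properties using (any⁺; any⁻)
  open import Data.Maybe using (just; nothing)
  open import Data.Maybe.Properties using (just-injective)
  open import Data.Nat using (ℕ; zero; suc; _+_; _∸_; _≤_; _<_; z≤n; s≤s)
  open import Data.Nat.Properties
    using (≡ᵇ⇒≡; ≡⇒≡ᵇ; m+n≡0⇒m≡0; m+n≡0⇒n≡0; ≤-refl; ≤-antisym; ≤-pred; <⇒≤; <-irrefl; m≤n⇒m≤1+n;
           +-suc; m<m+n; n∸n≡0; m∸n≡0⇒m≤n;
           m+n∸n≡m; +-∸-assoc; m+[n∸m]≡n; m∸n+n≡m)
  open import Data.Product using (_×_; _,_)
  open import Data.Sum using (_⊎_; inj₁; inj₂)
  open import Data.Unit using (⊤; tt)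
  open import Function using (_∘_; case_of_)
  open import Function.Bundles using (_⇔_; mk⇔; Equivalence)
  open import Relation.Binary.PropositionalEquality
  open Equivalence using (to; from)

  T-occupied : ∀ {p occ} → T (occupied p occ) ⇔ p ∈ occ
  T-occupied {p} {occ} = mk⇔ (Any.map (≡ᵇ⇒≡ p _) ∘ any⁻ _ occ) (any⁺ _ ∘ Any.map (≡⇒≡ᵇ p _))

  occupied-true : ∀ {p occ} → p ∈ occ → occupied p occ ≡ true
  occupied-true = T-≡ .to ∘ T-occupied .from

  occupied-false : ∀ {p occ} → p ∉ occ → occupied p occ ≡ false
  occupied-false {p} {occ} p∉ with occupied p occ in eq
  ... | true  = ⊥-elim (p∉ (T-occupied .to (subst T (sym eq) _)))
  ... | false = refl

  record FirstFree (occ : List ℕ) (a fuel p : ℕ) : Set where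
    field
      a≤p       : a ≤ p
      p<a+fuel  : p < a + fuel
      p∉occ     : p ∉ occ
      skipped-a : a < p → a ∈ occ

  firstFree-spec : ∀ occ a fuel {p} → firstFree occ a fuel ≡ just p → FirstFree occ a fuel p
  firstFree-spec occ a (suc fuel) {p} eq with occupied a occ in a-occ
  ... | true  = let open FirstFree (firstFree-spec occ (suc a) fuel eq) in record
    { a≤p       = <⇒≤ a≤p
    ; p<a+fuel  = subst (p <_) (sym (+-suc a fuel)) p<a+fuel
    ; p∉occ     = p∉occ
    ; skipped-a = λ _ → T-occupied .to (subst T (sym a-occ) _)
    }
  ... | false with refl ← eq = record
    { a≤p       = ≤-refl
    ; p<a+fuel  = m<m+n a (s≤s z≤n)
    ; p∉occ     = λ a∈ → subst T a-occ (T-occupied .from a∈)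
    ; skipped-a = λ a<a → ⊥-elim (<-irrefl refl a<a)
    }

  suc-∸ : ∀ {a n} → a ≤ n → suc n ∸ a ≡ suc (n ∸ a)
  suc-∸ = +-∸-assoc 1

  firstFree-here : ∀ {n occ a} → a ≤ n → a ∉ occ → firstFree occ a (suc n ∸ a) ≡ just a
  firstFree-here {n} {occ} {a} a≤n a∉ rewrite suc-∸ a≤n | occupied-false a∉ = refl

  suc-suc-∸ : ∀ {a n} → suc a ≤ n → suc n ∸ a ≡ suc (suc (n ∸ suc a))
  suc-suc-∸ {zero}  {suc n} _           = refl
  suc-suc-∸ {suc a} {suc n} (s≤s 1+a≤n) = suc-suc-∸ 1+a≤n

  firstFree-next : ∀ {n occ a} → suc a ≤ n → a ∈ occ → suc a ∉ occ → firstFree occ a (suc n ∸ a) ≡ just (suc a)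
  firstFree-next {n} {occ} {a} 1+a≤n a∈ 1+a∉
    rewrite suc-suc-∸ 1+a≤n | occupied-true a∈ | occupied-false 1+a∉ = refl

  record FirstCarRun (n a : ℕ) (ps occ : List ℕ) (d : ℕ) : Set where
    field
      spot   : ℕ
      rest   : ℕ
      found  : firstFree occ a (suc n ∸ a) ≡ just spot
      parks  : parkRun n ps (spot ∷ occ) ≡ just rest
      total  : (spot ∸ a) + rest ≡ d

  parkRun-∷⁻ : ∀ n a ps occ {d} → parkRun n (a ∷ ps) occ ≡ just d → FirstCarRun n a ps occ d
  parkRun-∷⁻ n a ps occ eq with firstFree occ a (suc n ∸ a) in found
  ... | just p with parkRun n ps (p ∷ occ) in parks
  ...   | just r = record { found = found ; parks = parks ; total = just-injective eq }
  parkRun-∷⁻ n a ps occ () | just p | nothing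
  parkRun-∷⁻ n a ps occ () | nothing

  parkRun-∷⁺ : ∀ n a ps occ {p d} → firstFree occ a (suc n ∸ a) ≡ just p → parkRun n ps (p ∷ occ) ≡ just d →
               parkRun n (a ∷ ps) occ ≡ just ((p ∸ a) + d)
  parkRun-∷⁺ n a ps occ found parks rewrite found | parks = refl

  Fresh : List ℕ → List ℕ → Set
  Fresh occ []       = ⊤
  Fresh occ (a ∷ ps) = a ∉ occ × Fresh (a ∷ occ) ps

  data OneBump (n : ℕ) : List ℕ → List ℕ → Set where
    bumped : ∀ {occ a ps} → a ∈ occ → suc a ∉ occ → suc a ≤ n → Fresh (suc a ∷ occ) ps → OneBump n occ (a ∷ ps)
    parked : ∀ {occ a ps} → a ∉ occ → OneBump n (a ∷ occ) ps → OneBump n occ (a ∷ ps)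

  parks-at-pref : ∀ {occ a fuel p} → FirstFree occ a fuel p → p ∸ a ≡ 0 → p ≡ a
  parks-at-pref ff p∸a≡0 = ≤-antisym (m∸n≡0⇒m≤n p∸a≡0) (FirstFree.a≤p ff)

  parks-after-pref : ∀ {occ a fuel p} → FirstFree occ a fuel p → p ∸ a ≡ 1 → p ≡ suc a
  parks-after-pref {a = a} ff p∸a≡1 = trans (sym (m∸n+n≡m (FirstFree.a≤p ff))) (cong (_+ a) p∸a≡1)

  spot≤n : ∀ {n occ a p} → a ≤ n → FirstFree occ a (suc n ∸ a) p → p ≤ n
  spot≤n {p = p} a≤n ff = ≤-pred (subst (p <_) (m+[n∸m]≡n (m≤n⇒m≤1+n a≤n)) (FirstFree.p<a+fuel ff))

  +≡1 : ∀ m {n} → m + n ≡ 1 → (m ≡ 0 × n ≡ 1) ⊎ (m ≡ 1 × n ≡ 0)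
  +≡1 zero          eq   = inj₁ (refl , eq)
  +≡1 (suc zero)    refl = inj₂ (refl , refl)

  module FirstCar (n a : ℕ) (ps occ : List ℕ) {d : ℕ} (eq : parkRun n (a ∷ ps) occ ≡ just d) where
    open FirstCarRun (parkRun-∷⁻ n a ps occ eq) public
    ff : FirstFree occ a (suc n ∸ a) spot
    ff = firstFree-spec occ a (suc n ∸ a) found
    open FirstFree ff public
    rest-parks : ∀ {r} → rest ≡ r → parkRun n ps (spot ∷ occ) ≡ just r
    rest-parks refl = parks

  parkRun≡0⇒Fresh : ∀ n ps occ → parkRun n ps occ ≡ just 0 → Fresh occ ps
  parkRun≡0⇒Fresh n []       occ _  = tt
  parkRun≡0⇒Fresh n (a ∷ ps) occ eq =
    subst (_∉ occ) spot≡a p∉occ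
    , subst (λ q → Fresh (q ∷ occ) ps) spot≡a (parkRun≡0⇒Fresh n ps _ (rest-parks (m+n≡0⇒n≡0 _ total)))
    where
      open FirstCar n a ps occ eq
      spot≡a : spot ≡ a
      spot≡a = parks-at-pref ff (m+n≡0⇒m≡0 _ total)

  parkRun≡1⇒OneBump : ∀ n ps occ → All (_≤ n) ps → parkRun n ps occ ≡ just 1 → OneBump n occ ps
  parkRun≡1⇒OneBump n (a ∷ ps) occ (a≤n ∷ ps≤n) eq = case +≡1 (spot ∸ a) total of λ where
      (inj₁ (moved≡0 , rest≡1)) → let spot≡a : spot ≡ a
                                      spot≡a = parks-at-pref ff moved≡0 in
        parked (subst (_∉ occ) spot≡a p∉occ)
               (subst (λ q → OneBump n (q ∷ occ) ps) spot≡a (parkRun≡1⇒OneBump n ps _ ps≤n (rest-parks rest≡1)))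
      (inj₂ (moved≡1 , rest≡0)) → let spot≡1+a : spot ≡ suc a
                                      spot≡1+a = parks-after-pref ff moved≡1 in
        bumped (skipped-a (subst (a <_) (sym spot≡1+a) ≤-refl))
               (subst (_∉ occ) spot≡1+a p∉occ)
               (subst (_≤ n) spot≡1+a (spot≤n a≤n ff))
               (subst (λ q → Fresh (q ∷ occ) ps) spot≡1+a (parkRun≡0⇒Fresh n ps _ (rest-parks rest≡0)))
    where open FirstCar n a ps occ eq

  Fresh⇒parkRun≡0 : ∀ n ps occ → All (_≤ n) ps → Fresh occ ps → parkRun n ps occ ≡ just 0
  Fresh⇒parkRun≡0 n []       occ []           _             = refl
  Fresh⇒parkRun≡0 n (a ∷ ps) occ (a≤n ∷ ps≤n) (a∉ , fresh) =
    trans (parkRun-∷⁺ n a ps occ (firstFree-here a≤n a∉) (Fresh⇒parkRun≡0 n ps _ ps≤n fresh))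
          (cong (λ m → just (m + 0)) (n∸n≡0 a))

  OneBump⇒parkRun≡1 : ∀ n ps occ → All (_≤ n) ps → OneBump n occ ps → parkRun n ps occ ≡ just 1
  OneBump⇒parkRun≡1 n (a ∷ ps) occ (a≤n ∷ ps≤n) (parked a∉ bump) =
    trans (parkRun-∷⁺ n a ps occ (firstFree-here a≤n a∉) (OneBump⇒parkRun≡1 n ps _ ps≤n bump))
          (cong (λ m → just (m + 1)) (n∸n≡0 a))
  OneBump⇒parkRun≡1 n (a ∷ ps) occ (a≤n ∷ ps≤n) (bumped a∈ 1+a∉ 1+a≤n fresh) =
    trans (parkRun-∷⁺ n a ps occ (firstFree-next 1+a≤n a∈ 1+a∉) (Fresh⇒parkRun≡0 n ps _ ps≤n fresh))
          (cong (λ m → just (m + 0)) (m+n∸n≡m 1 a))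

module LastCarSplit where

  open import Data.Bool using (if_then_else_)
  open import Data.Empty using (⊥)
  open import Data.List using (List; []; _∷_; _++_; [_])
  open import Data.List.Membership.Propositional using (_∈_; _∉_)
  open import Data.List.Relation.Unary.Any using (here; there)
  open import Data.Nat using (ℕ; suc; _≤_)
  open import Data.Product using (_×_; _,_)
  open import Data.Sum using (_⊎_; inj₁; inj₂)
  open import Data.Unit using (tt)
  open import Function using (_∘_)
  open import Relation.Binary.PropositionalEquality hiding ([_])

  open Parking

  ∈-move : ∀ {A : Set} {x a : A} {xs ys} → x ∈ xs ⊎ x ∈ a ∷ ys → x ∈ a ∷ xs ⊎ x ∈ ys
  ∈-move (inj₁ x∈)         = inj₁ (there x∈)
  ∈-move (inj₂ (here x≡a)) = inj₁ (here x≡a)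
  ∈-move (inj₂ (there x∈)) = inj₂ x∈

  ∈-move⁻ : ∀ {A : Set} {x a : A} {xs ys} → x ∈ a ∷ xs ⊎ x ∈ ys → x ∈ xs ⊎ x ∈ a ∷ ys
  ∈-move⁻ (inj₁ (here x≡a)) = inj₂ (here x≡a)
  ∈-move⁻ (inj₁ (there x∈)) = inj₁ x∈
  ∈-move⁻ (inj₂ x∈)         = inj₂ (there x∈)

  ∉-∷ : ∀ {A : Set} {x a : A} {xs} → x ≢ a → x ∉ xs → x ∉ a ∷ xs
  ∉-∷ x≢a x∉ (here x≡a) = x≢a x≡a
  ∉-∷ x≢a x∉ (there x∈) = x∉ x∈

  -- 0, which is not a spot, when no car is bumped.
  bumpSpot : List ℕ → List ℕ → ℕ
  bumpSpot occ []       = 0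
  bumpSpot occ (a ∷ ps) = if occupied a occ then suc a else bumpSpot (a ∷ occ) ps

  bumpSpot-bumped : ∀ {occ a} ps → a ∈ occ → bumpSpot occ (a ∷ ps) ≡ suc a
  bumpSpot-bumped ps a∈ rewrite occupied-true a∈ = refl

  bumpSpot-parked : ∀ {occ a} ps → a ∉ occ → bumpSpot occ (a ∷ ps) ≡ bumpSpot (a ∷ occ) ps
  bumpSpot-parked ps a∉ rewrite occupied-false a∉ = refl

  Fresh-∷ʳ⁻ : ∀ occ xs x → Fresh occ (xs ++ [ x ]) → Fresh occ xs × x ∉ xs × x ∉ occ
  Fresh-∷ʳ⁻ occ []       x (x∉ , _)     = tt , (λ ()) , x∉
  Fresh-∷ʳ⁻ occ (a ∷ xs) x (a∉ , fresh) with Fresh-∷ʳ⁻ (a ∷ occ) xs x fresh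
  ... | fresh′ , x∉xs , x∉a∷occ = (a∉ , fresh′) , ∉-∷ (x∉a∷occ ∘ here) x∉xs , x∉a∷occ ∘ there

  Fresh-∷ʳ⁺ : ∀ occ xs x → Fresh occ xs → x ∉ xs → x ∉ occ → Fresh occ (xs ++ [ x ])
  Fresh-∷ʳ⁺ occ []       x _            _    x∉occ = x∉occ , tt
  Fresh-∷ʳ⁺ occ (a ∷ xs) x (a∉ , fresh) x∉xs x∉occ =
    a∉ , Fresh-∷ʳ⁺ (a ∷ occ) xs x fresh (x∉xs ∘ there) (∉-∷ (x∉xs ∘ here) x∉occ)

  Fresh∧OneBump⇒⊥ : ∀ {n} occ ps → Fresh occ ps → OneBump n occ ps → ⊥
  Fresh∧OneBump⇒⊥ occ (a ∷ ps) (a∉ , _)     (bumped a∈ _ _ _) = a∉ a∈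
  Fresh∧OneBump⇒⊥ occ (a ∷ ps) (_ , fresh)  (parked _ bump)  = Fresh∧OneBump⇒⊥ (a ∷ occ) ps fresh bump

  record LastBumped (n : ℕ) (occ xs : List ℕ) (x : ℕ) : Set where
    constructor lastBumped
    field
      fresh    : Fresh occ xs
      x-taken  : x ∈ xs ⊎ x ∈ occ
      1+x∉xs   : suc x ∉ xs
      1+x∉occ  : suc x ∉ occ
      1+x≤n    : suc x ≤ n

  record LastParks (n : ℕ) (occ xs : List ℕ) (x : ℕ) : Set where
    constructor lastParks
    field
      bump       : OneBump n occ xs
      x∉xs       : x ∉ xs
      x∉occ      : x ∉ occ
      x≢bumpSpot : x ≢ bumpSpot occ xs

  OneBump-∷ʳ⁻ : ∀ {n} occ xs x → OneBump n occ (xs ++ [ x ]) → LastBumped n occ xs x ⊎ LastParks n occ xs x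
  OneBump-∷ʳ⁻ occ []       x (bumped x∈ 1+x∉ 1+x≤n _) = inj₁ (lastBumped tt (inj₂ x∈) (λ ()) 1+x∉ 1+x≤n)
  OneBump-∷ʳ⁻ occ (a ∷ xs) x (bumped a∈ 1+a∉ 1+a≤n fresh) with Fresh-∷ʳ⁻ (suc a ∷ occ) xs x fresh
  ... | fresh′ , x∉xs , x∉ = inj₂ (lastParks (bumped a∈ 1+a∉ 1+a≤n fresh′)
                                           (∉-∷ (λ { refl → x∉ (there a∈) }) x∉xs)
                                           (x∉ ∘ there)
                                           (subst (x ≢_) (sym (bumpSpot-bumped xs a∈)) (x∉ ∘ here)))
  OneBump-∷ʳ⁻ occ (a ∷ xs) x (parked a∉ bump) with OneBump-∷ʳ⁻ (a ∷ occ) xs x bump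
  ... | inj₁ (lastBumped fresh x-taken 1+x∉xs 1+x∉ 1+x≤n) =
    inj₁ (lastBumped (a∉ , fresh) (∈-move x-taken) (∉-∷ (1+x∉ ∘ here) 1+x∉xs) (1+x∉ ∘ there) 1+x≤n)
  ... | inj₂ (lastParks bump′ x∉xs x∉ x≢spot) =
    inj₂ (lastParks (parked a∉ bump′) (∉-∷ (x∉ ∘ here) x∉xs) (x∉ ∘ there)
                    (subst (x ≢_) (sym (bumpSpot-parked xs a∉)) x≢spot))

  OneBump-∷ʳ⁺ : ∀ {n} occ xs x → LastBumped n occ xs x ⊎ LastParks n occ xs x → OneBump n occ (xs ++ [ x ])
  OneBump-∷ʳ⁺ occ []       x (inj₁ (lastBumped _ (inj₂ x∈) _ 1+x∉ 1+x≤n)) = bumped x∈ 1+x∉ 1+x≤n tt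
  OneBump-∷ʳ⁺ occ (a ∷ xs) x (inj₁ (lastBumped (a∉ , fresh) x-taken 1+x∉xs 1+x∉ 1+x≤n)) =
    parked a∉ (OneBump-∷ʳ⁺ (a ∷ occ) xs x
                (inj₁ (lastBumped fresh (∈-move⁻ x-taken) (1+x∉xs ∘ there) (∉-∷ (1+x∉xs ∘ here) 1+x∉) 1+x≤n)))
  OneBump-∷ʳ⁺ occ (a ∷ xs) x (inj₂ (lastParks (bumped a∈ 1+a∉ 1+a≤n fresh) x∉xs x∉ x≢spot)) =
    bumped a∈ 1+a∉ 1+a≤n
      (Fresh-∷ʳ⁺ (suc a ∷ occ) xs x fresh (x∉xs ∘ there) (∉-∷ (subst (x ≢_) (bumpSpot-bumped xs a∈) x≢spot) x∉))
  OneBump-∷ʳ⁺ occ (a ∷ xs) x (inj₂ (lastParks (parked a∉ bump) x∉xs x∉ x≢spot)) =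
    parked a∉ (OneBump-∷ʳ⁺ (a ∷ occ) xs x
                (inj₂ (lastParks bump (x∉xs ∘ there) (∉-∷ (x∉xs ∘ here) x∉) (subst (x ≢_) (bumpSpot-parked xs a∉) x≢spot))))

  record BumpedCar (n : ℕ) (occ ps : List ℕ) : Set where
    field
      pref        : ℕ
      spot≡1+pref : bumpSpot occ ps ≡ suc pref
      pref-taken  : pref ∈ ps ⊎ pref ∈ occ
      1+pref≤n    : suc pref ≤ n

  bumpedCar : ∀ {n} occ ps → OneBump n occ ps → BumpedCar n occ ps
  bumpedCar occ (a ∷ ps) (bumped a∈ _ 1+a≤n _) = record
    { pref = a ; spot≡1+pref = bumpSpot-bumped ps a∈ ; pref-taken = inj₂ a∈ ; 1+pref≤n = 1+a≤n }
  bumpedCar occ (a ∷ ps) (parked a∉ bump) = record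
    { pref        = pref
    ; spot≡1+pref = trans (bumpSpot-parked ps a∉) spot≡1+pref
    ; pref-taken  = ∈-move pref-taken
    ; 1+pref≤n    = 1+pref≤n
    }
    where open BumpedCar (bumpedCar (a ∷ occ) ps bump)

module Relabelling where

  open import Data.Empty using (⊥-elim)
  open import Data.Fin using (Fin; zero; suc; toℕ; punchIn; punchOut)
  open import Data.List using (List; []; _∷_; map)
  open import Data.List.Membership.Propositional using (_∈_; _∉_)
  open import Data.List.Membership.Propositional.Properties using (∈-map⁺; ∈-map⁻)
  open import Data.List.Relation.Unary.All using (All; _∷_)
  import Data.List.Relation.Unary.All as All
  open import Data.Nat using (ℕ; zero; suc; pred; _≤_; z≤n; s≤s)
  open import Data.Nat.Properties using (suc-injective; pred-mono-≤)
  open import Data.Product using (_,_)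
  open import Data.Unit using (tt)
  open import Function using (_∘_)
  open import Relation.Binary.PropositionalEquality

  open Parking
  open LastCarSplit

  -- punchOutℕ x x is junk.
  punchInℕ : ℕ → ℕ → ℕ
  punchInℕ zero    v       = suc v
  punchInℕ (suc x) zero    = zero
  punchInℕ (suc x) (suc v) = suc (punchInℕ x v)

  punchOutℕ : ℕ → ℕ → ℕ
  punchOutℕ zero    v       = pred v
  punchOutℕ (suc x) zero    = zero
  punchOutℕ (suc x) (suc v) = suc (punchOutℕ x v)

  toℕ-punchIn : ∀ {n} (x : Fin (suc n)) (j : Fin n) → toℕ (punchIn x j) ≡ punchInℕ (toℕ x) (toℕ j)
  toℕ-punchIn zero    j       = refl
  toℕ-punchIn (suc x) zero    = refl
  toℕ-punchIn (suc x) (suc j) = cong suc (toℕ-punchIn x j)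

  toℕ-punchOut : ∀ {n} {x j : Fin (suc n)} (x≢j : x ≢ j) → toℕ (punchOut x≢j) ≡ punchOutℕ (toℕ x) (toℕ j)
  toℕ-punchOut {x = zero}  {zero}  x≢j = ⊥-elim (x≢j refl)
  toℕ-punchOut {x = zero}  {suc j} x≢j = refl
  toℕ-punchOut {suc n} {suc x} {zero}  x≢j = refl
  toℕ-punchOut {suc n} {suc x} {suc j} x≢j = cong suc (toℕ-punchOut (x≢j ∘ cong suc))

  punchInℕ-injective : ∀ x {u v} → punchInℕ x u ≡ punchInℕ x v → u ≡ v
  punchInℕ-injective zero    {u}     {v}     eq = suc-injective eq
  punchInℕ-injective (suc x) {zero}  {zero}  eq = refl
  punchInℕ-injective (suc x) {suc u} {suc v} eq = cong suc (punchInℕ-injective x (suc-injective eq))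

  punchOutℕ-injective : ∀ x {u v} → u ≢ x → v ≢ x → punchOutℕ x u ≡ punchOutℕ x v → u ≡ v
  punchOutℕ-injective zero    {zero}  {v}     u≢x _   _  = ⊥-elim (u≢x refl)
  punchOutℕ-injective zero    {suc u} {zero}  _   v≢x _  = ⊥-elim (v≢x refl)
  punchOutℕ-injective zero    {suc u} {suc v} _   _   eq = cong suc eq
  punchOutℕ-injective (suc x) {zero}  {zero}  _   _   _  = refl
  punchOutℕ-injective (suc x) {suc u} {suc v} u≢x v≢x eq =
    cong suc (punchOutℕ-injective x (u≢x ∘ cong suc) (v≢x ∘ cong suc) (suc-injective eq))

  punchInℕ-≢ : ∀ x v → punchInℕ x v ≢ x
  punchInℕ-≢ (suc x) (suc v) eq = punchInℕ-≢ x v (suc-injective eq)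

  punchInℕ-suc : ∀ x a → suc a ≢ x → punchInℕ x (suc a) ≡ suc (punchInℕ x a)
  punchInℕ-suc zero          a       _    = refl
  punchInℕ-suc (suc zero)    zero    1≢1  = ⊥-elim (1≢1 refl)
  punchInℕ-suc (suc (suc x)) zero    _    = refl
  punchInℕ-suc (suc x)       (suc a) ≢x   = cong suc (punchInℕ-suc x a (≢x ∘ cong suc))

  punchOutℕ-suc : ∀ x a → a ≢ x → suc a ≢ x → punchOutℕ x (suc a) ≡ suc (punchOutℕ x a)
  punchOutℕ-suc zero    zero    a≢x _     = ⊥-elim (a≢x refl)
  punchOutℕ-suc zero    (suc a) _   _     = refl
  punchOutℕ-suc (suc x) zero    _   _     = cong suc (punchOutℕ-zero x)
    where punchOutℕ-zero : ∀ x → punchOutℕ x 0 ≡ 0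
          punchOutℕ-zero zero    = refl
          punchOutℕ-zero (suc x) = refl
  punchOutℕ-suc (suc x) (suc a) a≢x 1+a≢x = cong suc (punchOutℕ-suc x a (a≢x ∘ cong suc) (1+a≢x ∘ cong suc))

  punchInℕ-≤ : ∀ x {v m} → v ≤ m → punchInℕ x v ≤ suc m
  punchInℕ-≤ zero    v≤m       = s≤s v≤m
  punchInℕ-≤ (suc x) z≤n       = z≤n
  punchInℕ-≤ (suc x) (s≤s v≤m) = s≤s (punchInℕ-≤ x v≤m)

  punchOutℕ-≤ : ∀ x {v n} → v ≤ n → x ≤ n → v ≢ x → punchOutℕ x v ≤ pred n
  punchOutℕ-≤ zero    v≤n _ _ = pred-mono-≤ v≤n
  punchOutℕ-≤ (suc x) {zero}  _ _ _ = z≤n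
  punchOutℕ-≤ (suc x) {suc v} {suc zero}    (s≤s z≤n) (s≤s z≤n) v≢x = ⊥-elim (v≢x refl)
  punchOutℕ-≤ (suc x) {suc v} {suc (suc n)} (s≤s v≤n) (s≤s x≤n) v≢x = s≤s (punchOutℕ-≤ x v≤n x≤n (v≢x ∘ cong suc))

  punchOutℕ-≢ : ∀ x a → a ≢ x → a ≢ suc x → punchOutℕ x a ≢ x
  punchOutℕ-≢ zero    zero          a≢x _    _  = a≢x refl
  punchOutℕ-≢ zero    (suc zero)    _   a≢1  _  = a≢1 refl
  punchOutℕ-≢ (suc x) (suc a) a≢x a≢2+x eq = punchOutℕ-≢ x a (a≢x ∘ cong suc) (a≢2+x ∘ cong suc) (suc-injective eq)

  module Relabel (R : ℕ → ℕ) (Q : ℕ → Set) (R-injective : ∀ {u v} → Q u → Q v → R u ≡ R v → u ≡ v) where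

    ∉-map : ∀ {a occ} → All Q occ → Q a → a ∉ occ → R a ∉ map R occ
    ∉-map {occ = occ} Qocc Qa a∉ Ra∈ with ∈-map⁻ R Ra∈
    ... | u , u∈ , Ra≡Ru = a∉ (subst (_∈ occ) (sym (R-injective Qa (All.lookup Qocc u∈) Ra≡Ru)) u∈)

    Fresh-map : ∀ occ ps → All Q occ → All Q ps → Fresh occ ps → Fresh (map R occ) (map R ps)
    Fresh-map occ []       _    _          _            = tt
    Fresh-map occ (a ∷ ps) Qocc (Qa ∷ Qps) (a∉ , fresh) = ∉-map Qocc Qa a∉ , Fresh-map (a ∷ occ) ps (Qa ∷ Qocc) Qps fresh

    record BumpRespected (n : ℕ) (occ ps : List ℕ) : Set where
      field
        Q-spot   : Q (bumpSpot occ ps)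
        R-suc    : ∀ a → bumpSpot occ ps ≡ suc a → R (suc a) ≡ suc (R a)
        R-spot≤n : R (bumpSpot occ ps) ≤ n

    BumpRespected-parked : ∀ {n occ a} ps → a ∉ occ → BumpRespected n occ (a ∷ ps) → BumpRespected n (a ∷ occ) ps
    BumpRespected-parked {n} {occ} {a} ps a∉ resp = record
      { Q-spot   = subst Q spot≡ Q-spot
      ; R-suc    = λ b eq → R-suc b (trans spot≡ eq)
      ; R-spot≤n = subst (λ t → R t ≤ n) spot≡ R-spot≤n
      }
      where open BumpRespected resp
            spot≡ : bumpSpot occ (a ∷ ps) ≡ bumpSpot (a ∷ occ) ps
            spot≡ = bumpSpot-parked ps a∉

    OneBump-map : ∀ {n n′} occ ps → All Q occ → All Q ps → BumpRespected n′ occ ps → OneBump n occ ps →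
                  OneBump n′ (map R occ) (map R ps)
    OneBump-map occ (a ∷ ps) Qocc (_ ∷ Qps) resp (bumped a∈ 1+a∉ _ fresh) =
      bumped (∈-map⁺ R a∈) (subst (_∉ map R occ) R1+a≡ (∉-map Qocc Q1+a 1+a∉))
             (subst (_≤ _) (trans (cong R spot≡) R1+a≡) R-spot≤n)
             (subst (λ t → Fresh (t ∷ map R occ) (map R ps)) R1+a≡ (Fresh-map (suc a ∷ occ) ps (Q1+a ∷ Qocc) Qps fresh))
      where
        open BumpRespected resp
        spot≡ : bumpSpot occ (a ∷ ps) ≡ suc a
        spot≡ = bumpSpot-bumped ps a∈
        Q1+a : Q (suc a)
        Q1+a = subst Q spot≡ Q-spot
        R1+a≡ : R (suc a) ≡ suc (R a)
        R1+a≡ = R-suc a spot≡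
    OneBump-map occ (a ∷ ps) Qocc (Qa ∷ Qps) resp (parked a∉ bump) =
      parked (∉-map Qocc Qa a∉) (OneBump-map (a ∷ occ) ps (Qa ∷ Qocc) Qps (BumpRespected-parked ps a∉ resp) bump)

    bumpSpot-map : ∀ {n n′} occ ps → All Q occ → All Q ps → BumpRespected n′ occ ps → OneBump n occ ps →
                   bumpSpot (map R occ) (map R ps) ≡ R (bumpSpot occ ps)
    bumpSpot-map occ (a ∷ ps) Qocc Qps resp (bumped a∈ _ _ _) =
      trans (bumpSpot-bumped (map R ps) (∈-map⁺ R a∈)) (trans (sym (R-suc a spot≡)) (cong R (sym spot≡)))
      where
        open BumpRespected resp
        spot≡ : bumpSpot occ (a ∷ ps) ≡ suc a
        spot≡ = bumpSpot-bumped ps a∈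
    bumpSpot-map occ (a ∷ ps) Qocc (Qa ∷ Qps) resp (parked a∉ bump) =
      trans (bumpSpot-parked (map R ps) (∉-map Qocc Qa a∉))
            (trans (bumpSpot-map (a ∷ occ) ps (Qa ∷ Qocc) Qps (BumpRespected-parked ps a∉ resp) bump)
                   (cong R (sym (bumpSpot-parked ps a∉))))

module PF₁Recursion where

  open import Axiom.UniquenessOfIdentityProofs using (module Decidable⇒UIP)
  open import Data.Empty using (⊥-elim)
  open import Data.Fin using (Fin; zero; suc; toℕ; inject₁; punchIn; punchOut)
  open import Data.Fin.Properties
    using (toℕ-injective; toℕ-inject₁; toℕ<n; inject₁ℕ<; punchInᵢ≢i; punchIn-punchOut; punchOut-cong; punchOut-punchIn)
  import Data.List as List
  open import Data.List using (List; []; _∷_; _++_; [_])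
  import Data.List.Membership.Propositional as ListMembership
  open import Data.List.Membership.Propositional.Properties using () renaming (∈-map⁺ to ∈ₗ-map⁺; ∈-map⁻ to ∈ₗ-map⁻)
  open import Data.List.Relation.Unary.All using (All; []; _∷_)
  import Data.List.Relation.Unary.All as All
  open import Data.Maybe using (just)
  open import Data.Maybe.Properties using (≡-dec)
  open import Data.Nat using (ℕ; suc; pred; _+_; _≤_; s≤s)
  import Data.Nat.Properties as ℕ
  open import Data.Product using (_×_; _,_; proj₁)
  open import Data.Sum using (_⊎_; inj₁; inj₂)
  open import Data.Unit using (⊤; tt)
  open import Data.Vec using (Vec; []; _∷_; map; toList; _∷ʳ_; init; last)
  open import Data.Vec.Membership.Propositional using (_∈_; _∉_)
  open import Data.Vec.Membership.Propositional.Properties using (∈-map⁺; ∈-toList⁺; ∈-toList⁻)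
  open import Data.Vec.Relation.Unary.Any using (here; there)
  open import Data.List.Relation.Unary.Any using (here; there)
  open import Data.Vec.Properties using (init-∷ʳ; last-∷ʳ)
  open import Function using (_∘_)
  open import Function.Bundles using (_↔_; mk↔ₛ′)
  open import Relation.Binary.PropositionalEquality hiding ([_])
  open import Relation.Nullary.Decidable using (toWitness; fromWitness)
  open ListMembership using () renaming (_∈_ to _∈ₗ_; _∉_ to _∉ₗ_)

  open FiniteMaps
  open Parking
  open LastCarSplit
  open Relabelling

  prefs : ∀ {n m} → Vec (Fin n) m → List ℕ
  prefs v = List.map (λ i → suc (toℕ i)) (toList v)

  prefs-∷ʳ : ∀ {n m} (v : Vec (Fin n) m) x → prefs (v ∷ʳ x) ≡ prefs v ++ [ suc (toℕ x) ]
  prefs-∷ʳ []      x = refl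
  prefs-∷ʳ (y ∷ v) x = cong (suc (toℕ y) ∷_) (prefs-∷ʳ v x)

  prefs-bounded : ∀ {n m} (v : Vec (Fin n) m) → All (_≤ n) (prefs v)
  prefs-bounded []      = []
  prefs-bounded (y ∷ v) = toℕ<n y ∷ prefs-bounded v

  prefs-map-punchIn : ∀ {m k} (x : Fin (suc k)) (u : Vec (Fin k) m) →
                      prefs (map (punchIn x) u) ≡ List.map (punchInℕ (suc (toℕ x))) (prefs u)
  prefs-map-punchIn x []      = refl
  prefs-map-punchIn x (j ∷ u) = cong₂ _∷_ (cong suc (toℕ-punchIn x j)) (prefs-map-punchIn x u)

  prefs-punchOutAll : ∀ {m k} (x : Fin (suc k)) (w : Vec (Fin (suc k)) m) (x∉w : x ∉ w) →
                      prefs (punchOutAll x w x∉w) ≡ List.map (punchOutℕ (suc (toℕ x))) (prefs w)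
  prefs-punchOutAll x []      _   = refl
  prefs-punchOutAll x (j ∷ w) x∉w = cong₂ _∷_ (cong suc (toℕ-punchOut (x∉w ∘ here))) (prefs-punchOutAll x w _)

  ∈-prefs : ∀ {n m} {v : Vec (Fin n) m} {j} → j ∈ v → suc (toℕ j) ∈ₗ prefs v
  ∈-prefs = ∈ₗ-map⁺ _ ∘ ∈-toList⁺

  ∈-prefs⁻ : ∀ {n m} {v : Vec (Fin n) m} {j} → suc (toℕ j) ∈ₗ prefs v → j ∈ v
  ∈-prefs⁻ {v = v} {j} j∈ with ∈ₗ-map⁻ _ j∈
  ... | i , i∈ , eq = subst (_∈ v) (toℕ-injective (ℕ.suc-injective (sym eq))) (∈-toList⁻ i∈)

  Fresh-prefs⁻ : ∀ {n m} occ (v : Vec (Fin n) m) → Fresh occ (prefs v) → Distinct v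
  Fresh-prefs⁻ occ []      _            = tt
  Fresh-prefs⁻ occ (y ∷ v) (_ , fresh) = (λ y∈ → fresh-∉ fresh (∈-prefs y∈) (here refl)) , Fresh-prefs⁻ _ v fresh
    where fresh-∉ : ∀ {occ ps p} → Fresh occ ps → p ∈ₗ ps → p ∉ₗ occ
          fresh-∉ {ps = _ ∷ _} (a∉ , _)     (here refl) = a∉
          fresh-∉ {ps = _ ∷ _} (_ , fresh′) (there p∈)  = fresh-∉ fresh′ p∈ ∘ there

  Fresh-prefs⁺ : ∀ {n m} occ (v : Vec (Fin n) m) → Distinct v → (∀ j → j ∈ v → suc (toℕ j) ∉ₗ occ) → Fresh occ (prefs v)
  Fresh-prefs⁺ occ []      _            _    = tt
  Fresh-prefs⁺ occ (y ∷ v) (y∉v , dist) disj =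
    disj y (here refl) , Fresh-prefs⁺ _ v dist λ j j∈ → ∉-∷ (y≢ j j∈) (disj j (there j∈))
    where y≢ : ∀ j → j ∈ v → suc (toℕ j) ≢ suc (toℕ y)
          y≢ j j∈ eq = y∉v (subst (_∈ v) (toℕ-injective (ℕ.suc-injective eq)) j∈)

  LastCar : ∀ {m} → Vec (Fin (suc m)) m → Fin (suc m) → Set
  LastCar {m} v x = LastBumped (suc m) [] (prefs v) (suc (toℕ x)) ⊎ LastParks (suc m) [] (prefs v) (suc (toℕ x))

  lastCar⁻ : ∀ {m} (v : Vec (Fin (suc m)) m) x → displacement (suc m) (v ∷ʳ x) ≡ just 1 → LastCar v x
  lastCar⁻ {m} v x e = OneBump-∷ʳ⁻ [] (prefs v) _
    (subst (OneBump (suc m) []) (prefs-∷ʳ v x) (parkRun≡1⇒OneBump _ _ [] (prefs-bounded (v ∷ʳ x)) e))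

  lastCar⁺ : ∀ {m} (v : Vec (Fin (suc m)) m) x → LastCar v x → displacement (suc m) (v ∷ʳ x) ≡ just 1
  lastCar⁺ {m} v x c = OneBump⇒parkRun≡1 _ _ [] (prefs-bounded (v ∷ʳ x))
    (subst (OneBump (suc m) []) (sym (prefs-∷ʳ v x)) (OneBump-∷ʳ⁺ [] (prefs v) _ c))

  PF₁-≡ : ∀ {n} {α α′ : Vec (Fin n) n} {p q} → α ≡ α′ → _≡_ {A = PF₁ n} (α , p) (α′ , q)
  PF₁-≡ = Σ-≡-irrelevant (Decidable⇒UIP.≡-irrelevant (≡-dec ℕ._≟_))

  inject₁≡punchIn-suc : ∀ {m} (y : Fin m) → inject₁ y ≡ punchIn (suc y) y
  inject₁≡punchIn-suc zero    = refl
  inject₁≡punchIn-suc (suc y) = cong suc (inject₁≡punchIn-suc y)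

  punchOut-punchIn′ : ∀ {m} {i i′ : Fin (suc m)} {y} → i ≡ i′ → (i≢ : i ≢ punchIn i′ y) → punchOut i≢ ≡ y
  punchOut-punchIn′ {i = i} refl i≢ = trans (punchOut-cong i refl) (punchOut-punchIn i)

  -- Splitting off the last car x of α ∈ PF₁(k+2).  If x is the bumped car, the other
  -- cars prefer distinct spots, all but the one after x; punching that spot out of them
  -- leaves a permutation, and x is one of the first k+1 spots.  If x parks at its preference,
  -- punching x out of the other cars leaves β ∈ PF₁(k+1), and x is recorded by its
  -- index among the spots other than bumpIndex β, the one taken by β's bumped car.
  module PF₁Step (k : ℕ) where

    K N : ℕ
    K = suc k
    N = suc (suc k)

    Split : Set
    Split = (Fin K × Injections K K) ⊎ (Fin K × PF₁ K)

    bumpIndex : Vec (Fin K) K → Fin K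
    bumpIndex β = clamp k (pred (bumpSpot [] (prefs β)))

    module LastBumpedSplit (v : Vec (Fin N) K) (x : Fin N) (L : LastBumped N [] (prefs v) (suc (toℕ x))) where
      open LastBumped L

      x≤k : toℕ x ≤ k
      x≤k = ℕ.≤-pred (ℕ.≤-pred 1+x≤n)

      y : Fin K
      y = clamp k (toℕ x)

      1+y∉v : suc y ∉ v
      1+y∉v 1+y∈ = 1+x∉xs (subst (_∈ₗ prefs v) (cong (2 +_) (toℕ-clamp x≤k)) (∈-prefs 1+y∈))

      ρ : Vec (Fin K) K
      ρ = punchOutAll (suc y) v 1+y∉v

      ρ-distinct : Distinct ρ
      ρ-distinct = distinct-punchOutAll (suc y) v 1+y∉v (Fresh-prefs⁻ [] v fresh)

      inject₁y≡x : inject₁ y ≡ x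
      inject₁y≡x = toℕ-injective (trans (toℕ-inject₁ y) (toℕ-clamp x≤k))

    module LastBumpedJoin (y : Fin K) (ρ : Vec (Fin K) K) (ρ-distinct : Distinct ρ) where

      v : Vec (Fin N) K
      v = map (punchIn (suc y)) ρ

      fresh : Fresh [] (prefs v)
      fresh = Fresh-prefs⁺ [] v (distinct-map-punchIn (suc y) ρ ρ-distinct) (λ _ _ ())

      lastBumped′ : LastBumped N [] (prefs v) (suc (toℕ (inject₁ y)))
      lastBumped′ = lastBumped fresh (inj₁ (∈-prefs y∈v)) 2+y∉ (λ ()) (s≤s (s≤s (ℕ.≤-pred (inject₁ℕ< y))))
        where
          y∈v : inject₁ y ∈ v
          y∈v = subst (_∈ v) (sym (inject₁≡punchIn-suc y)) (∈-map⁺ (punchIn (suc y)) (distinct⇒onto ρ ρ-distinct y))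
          2+y∉ : suc (suc (toℕ (inject₁ y))) ∉ₗ prefs v
          2+y∉ 2+y∈ = ∉-map-punchIn (suc y) ρ (∈-prefs⁻ (subst (_∈ₗ prefs v) (cong (2 +_) (toℕ-inject₁ y)) 2+y∈))

    module LastParksSplit (v : Vec (Fin N) K) (x : Fin N) (L : LastParks N [] (prefs v) (suc (toℕ x))) where
      open LastParks L

      X : ℕ
      X = suc (toℕ x)

      x∉v : x ∉ v
      x∉v = x∉xs ∘ ∈-prefs

      β : Vec (Fin K) K
      β = punchOutAll x v x∉v

      prefs-β : prefs β ≡ List.map (punchOutℕ X) (prefs v)
      prefs-β = prefs-punchOutAll x v x∉v

      open Relabel (punchOutℕ X) (_≢ X) (punchOutℕ-injective X)

      open BumpedCar (bumpedCar [] (prefs v) bump) renaming (pref to b)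

      b≢X : b ≢ X
      b≢X with pref-taken
      ... | inj₁ b∈ = λ b≡X → x∉xs (subst (_∈ₗ prefs v) b≡X b∈)

      spot≢X : bumpSpot [] (prefs v) ≢ X
      spot≢X = x≢bumpSpot ∘ sym

      b≢x : b ≢ toℕ x
      b≢x = spot≢X ∘ trans spot≡1+pref ∘ cong suc

      respected : BumpRespected K [] (prefs v)
      respected = record
        { Q-spot   = spot≢X
        ; R-suc    = λ a spot≡1+a → punchOutℕ-suc X a (b≢X ∘ trans (ℕ.suc-injective (trans (sym spot≡1+pref) spot≡1+a)))
                                                      (spot≢X ∘ trans spot≡1+a)
        ; R-spot≤n = punchOutℕ-≤ X (subst (_≤ N) (sym spot≡1+pref) 1+pref≤n) (toℕ<n x) spot≢X
        }

      v-avoids-X : All (_≢ X) (prefs v)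
      v-avoids-X = ∉⇒All≢ (prefs v) x∉xs
        where ∉⇒All≢ : ∀ ps → X ∉ₗ ps → All (_≢ X) ps
              ∉⇒All≢ []       _  = []
              ∉⇒All≢ (a ∷ ps) X∉ = (X∉ ∘ here ∘ sym) ∷ ∉⇒All≢ ps (X∉ ∘ there)

      β-displacement : displacement K β ≡ just 1
      β-displacement = OneBump⇒parkRun≡1 K (prefs β) [] (prefs-bounded β)
        (subst (OneBump K []) (sym prefs-β) (OneBump-map [] (prefs v) [] v-avoids-X respected bump))

      bumpSpot-β : bumpSpot [] (prefs β) ≡ suc (punchOutℕ (toℕ x) b)
      bumpSpot-β = trans (cong (bumpSpot []) prefs-β)
                         (trans (bumpSpot-map [] (prefs v) [] v-avoids-X respected bump) (cong (punchOutℕ X) spot≡1+pref))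

      toℕ-bumpIndex : toℕ (bumpIndex β) ≡ punchOutℕ (toℕ x) b
      toℕ-bumpIndex = trans (cong (toℕ ∘ clamp k ∘ pred) bumpSpot-β) (toℕ-clamp (ℕ.≤-pred bound))
        where bound : suc (punchOutℕ (toℕ x) b) ≤ K
              bound = subst (_≤ K) (cong (punchOutℕ X) spot≡1+pref) (BumpRespected.R-spot≤n respected)

      bumpIndex≢x : inject₁ (bumpIndex β) ≢ x
      bumpIndex≢x eq = punchOutℕ-≢ (toℕ x) b b≢x b≢X
                         (trans (sym toℕ-bumpIndex) (trans (sym (toℕ-inject₁ _)) (cong toℕ eq)))

      y : Fin K
      y = punchOut bumpIndex≢x

    module LastParksJoin (y : Fin K) (β : Vec (Fin K) K) (e : displacement K β ≡ just 1) where

      x : Fin N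
      x = punchIn (inject₁ (bumpIndex β)) y

      X : ℕ
      X = suc (toℕ x)

      v : Vec (Fin N) K
      v = map (punchIn x) β

      β-bump : OneBump K [] (prefs β)
      β-bump = parkRun≡1⇒OneBump K (prefs β) [] (prefs-bounded β) e

      open BumpedCar (bumpedCar [] (prefs β) β-bump) renaming (pref to b)
      open Relabel (punchInℕ X) (λ _ → ⊤) (λ _ _ → punchInℕ-injective X)

      toℕ-bumpIndex : toℕ (bumpIndex β) ≡ b
      toℕ-bumpIndex = trans (cong (toℕ ∘ clamp k ∘ pred) spot≡1+pref) (toℕ-clamp (ℕ.≤-pred 1+pref≤n))

      X≢spot : X ≢ bumpSpot [] (prefs β)
      X≢spot X≡spot = punchInᵢ≢i (inject₁ (bumpIndex β)) y (toℕ-injective (ℕ.suc-injective (begin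
        suc (toℕ x)                        ≡⟨ X≡spot ⟩
        bumpSpot [] (prefs β)              ≡⟨ spot≡1+pref ⟩
        suc b                              ≡⟨ cong suc toℕ-bumpIndex ⟨
        suc (toℕ (bumpIndex β))            ≡⟨ cong suc (toℕ-inject₁ _) ⟨
        suc (toℕ (inject₁ (bumpIndex β)))  ∎)))
        where open ≡-Reasoning

      all-⊤ : ∀ (ps : List ℕ) → All (λ _ → ⊤) ps
      all-⊤ = All.universal (λ _ → tt)

      respected : BumpRespected N [] (prefs β)
      respected = record
        { Q-spot   = tt
        ; R-suc    = λ a spot≡1+a → punchInℕ-suc X a (λ 1+a≡X → X≢spot (sym (trans spot≡1+a 1+a≡X)))
        ; R-spot≤n = punchInℕ-≤ X (subst (_≤ K) (sym spot≡1+pref) 1+pref≤n)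
        }

      v-bump : OneBump N [] (prefs v)
      v-bump = subst (OneBump N []) (sym (prefs-map-punchIn x β))
                     (OneBump-map [] (prefs β) [] (all-⊤ (prefs β)) respected β-bump)

      lastParks′ : LastParks N [] (prefs v) X
      lastParks′ = lastParks v-bump (∉-map-punchIn x β ∘ ∈-prefs⁻) (λ ())
        λ X≡spot → punchInℕ-≢ X (bumpSpot [] (prefs β)) (sym (trans X≡spot (begin
          bumpSpot [] (prefs v)                          ≡⟨ cong (bumpSpot []) (prefs-map-punchIn x β) ⟩
          bumpSpot [] (List.map (punchInℕ X) (prefs β))  ≡⟨ bumpSpot-map [] (prefs β) [] (all-⊤ (prefs β))
                                                                           respected β-bump ⟩
          punchInℕ X (bumpSpot [] (prefs β))             ∎)))
        where open ≡-Reasoning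

    classify : (v : Vec (Fin N) K) (x : Fin N) → LastCar v x → Split
    classify v x (inj₁ L) = inj₁ (y , ρ , fromWitness ρ-distinct)  where open LastBumpedSplit v x L
    classify v x (inj₂ L) = inj₂ (y , β , β-displacement)           where open LastParksSplit v x L

    lastCarOf : ∀ (α : Vec (Fin N) N) → displacement N α ≡ just 1 → LastCar (init α) (last α)
    lastCarOf α e = lastCar⁻ (init α) (last α) (subst (λ t → displacement N t ≡ just 1) (init∷ʳlast α) e)

    toSplit : PF₁ N → Split
    toSplit (α , e) = classify (init α) (last α) (lastCarOf α e)

    fromSplit : Split → PF₁ N
    fromSplit (inj₁ (y , ρ , p)) = LastBumpedJoin.v y ρ (toWitness p) ∷ʳ inject₁ y
                                 , lastCar⁺ _ _ (inj₁ (LastBumpedJoin.lastBumped′ y ρ (toWitness p)))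
    fromSplit (inj₂ (y , β , e)) = LastParksJoin.v y β e ∷ʳ LastParksJoin.x y β e
                                 , lastCar⁺ _ _ (inj₂ (LastParksJoin.lastParks′ y β e))

    fromSplit-classify : ∀ v x c → proj₁ (fromSplit (classify v x c)) ≡ v ∷ʳ x
    fromSplit-classify v x (inj₁ L) = cong₂ _∷ʳ_ (map-punchIn-punchOutAll (suc y) v 1+y∉v) inject₁y≡x
      where open LastBumpedSplit v x L
    fromSplit-classify v x (inj₂ L) = begin
      map (punchIn x′) β ∷ʳ x′ ≡⟨ cong (λ t → map (punchIn t) β ∷ʳ t) (punchIn-punchOut bumpIndex≢x) ⟩
      map (punchIn x) β ∷ʳ x   ≡⟨ cong (_∷ʳ x) (map-punchIn-punchOutAll x v x∉v) ⟩
      v ∷ʳ x                   ∎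
      where open LastParksSplit v x L
            open ≡-Reasoning
            x′ : Fin N
            x′ = punchIn (inject₁ (bumpIndex β)) y

    -- init (v ∷ʳ x) and last (v ∷ʳ x) are v and x only propositionally.
    classify-bumped : ∀ y ρ p v′ x′ c → v′ ≡ LastBumpedJoin.v y ρ (toWitness p) → x′ ≡ inject₁ y →
                      classify v′ x′ c ≡ inj₁ (y , ρ , p)
    classify-bumped y ρ p _ _ (inj₁ L) refl refl =
      cong₂ (λ a b → inj₁ (a , b)) y′≡y (Σ-T-≡ (punchOutAll-map-punchIn (cong suc y′≡y) ρ _))
      where y′≡y : LastBumpedSplit.y (LastBumpedJoin.v y ρ (toWitness p)) (inject₁ y) L ≡ y
            y′≡y = trans (cong (clamp k) (toℕ-inject₁ y)) (clamp-toℕ k y)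
    classify-bumped y ρ p _ _ (inj₂ L) refl refl =
      ⊥-elim (Fresh∧OneBump⇒⊥ [] _ (LastBumpedJoin.fresh y ρ (toWitness p)) (LastParks.bump L))

    classify-parks : ∀ y β e v′ x′ c → v′ ≡ LastParksJoin.v y β e → x′ ≡ LastParksJoin.x y β e →
                     classify v′ x′ c ≡ inj₂ (y , β , e)
    classify-parks y β e _ _ (inj₁ L) refl refl =
      ⊥-elim (Fresh∧OneBump⇒⊥ [] _ (LastBumped.fresh L) (LastParksJoin.v-bump y β e))
    classify-parks y β e _ _ (inj₂ L) refl refl =
      cong₂ (λ a b → inj₂ (a , b)) (punchOut-punchIn′ (cong (inject₁ ∘ bumpIndex) β′≡β) bumpIndex≢x)
                                   (PF₁-≡ β′≡β)
      where open LastParksSplit (LastParksJoin.v y β e) (LastParksJoin.x y β e) L using (bumpIndex≢x) renaming (β to β′)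
            β′≡β : β′ ≡ β
            β′≡β = punchOutAll-map-punchIn refl β _

    PF₁↔Split : PF₁ N ↔ Split
    PF₁↔Split = mk↔ₛ′ toSplit fromSplit toSplit∘fromSplit fromSplit∘toSplit
      where
        toSplit∘fromSplit : ∀ s → toSplit (fromSplit s) ≡ s
        toSplit∘fromSplit (inj₁ (y , ρ , p)) = let open LastBumpedJoin y ρ (toWitness p) using (v) in
          classify-bumped y ρ p _ _ _ (init-∷ʳ (inject₁ y) v) (last-∷ʳ (inject₁ y) v)
        toSplit∘fromSplit (inj₂ (y , β , e)) = let open LastParksJoin y β e using (v; x) in
          classify-parks y β e _ _ _ (init-∷ʳ x v) (last-∷ʳ x v)
        fromSplit∘toSplit : ∀ α → fromSplit (toSplit α) ≡ α
        fromSplit∘toSplit (α , e) = PF₁-≡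
          (trans (fromSplit-classify (init α) (last α) (lastCarOf α e)) (sym (init∷ʳlast α)))

open FiniteMaps
open Counts
open Hanoi
open PF₁Recursion

TH↔ : ∀ m → TH (suc m) ↔ Fin (pf₁Count (suc m))
TH↔ zero    = ∅↔Fin0 TH₁-empty
TH↔ (suc m) = ↔-trans (IdealStates.TH↔Surjections m)
                      (↔Fin-cast (surjCount[1+n,n]≡pf₁Count[1+n] (suc m)) (Surjections↔ (suc (suc m)) (suc m)))

PF₁↔ : ∀ k → PF₁ (suc k) ↔ Fin (pf₁Count (suc k))
PF₁↔ zero    = ∅↔Fin0 λ { (zero ∷ [] , ()) }
PF₁↔ (suc k) = ↔Fin-cast (sym (*-distribˡ-+ (suc k) (suc k !) (pf₁Count (suc k))))
  (↔-trans (PF₁Step.PF₁↔Split k)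
    (⊎↔Fin (×↔Fin (↔-refl {A = Fin (suc k)}) (Permutations↔ (suc k)))
           (×↔Fin (↔-refl {A = Fin (suc k)}) (PF₁↔ k))))

theorem4 : (n : ℕ) → 1 ≤ n →
    (TH n ↔ Fin ((n ! * (n ∸ 1)) / 2)) × (PF₁ n ↔ Fin ((n ! * (n ∸ 1)) / 2))
theorem4 (suc k) _ = ↔Fin-cast closed-form (TH↔ k) , ↔Fin-cast closed-form (PF₁↔ k)
  where closed-form : pf₁Count (suc k) ≡ (suc k ! * (suc k ∸ 1)) / 2
        closed-form = sym ([1+k]!*k/2≡pf₁Count[1+k] k)
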